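{- Let $w$ be a finite Dean word with $|w|\ge 24$ such that each of the eight reduced words of length $2$ (namely $01,03,21,23,10,12,30,32$) occurs as a factor of some proper prefix of $w$ (a prefix $v$ with $|v|<|w|$). Then $\mathit{d}_3(w)\le 6$.
   Context: Words are over the alphabet $\Sigma_4=\{0,1,2,3\}$. A word is reduced if it has no factor in $\{02,20,13,31\}$. A Dean word is a reduced square-free word (no factor $uu$ with $u$ nonempty). For a Dean word $w$, $\mathit{D}_3(w)$ is the set of reduced words $v$ of length $3$ that are not factors of $w$ but whose prefix and suffix of length $2$ are factors of $w$; $\mathit{d}_3(w)=|\mathit{D}_3(w)|$. -}

module Defs where

open import Data.Fin using (Fin; zero; suc)
open import Data.List using (List; []; _∷_; _++_; length)
open import Data.Product using (Σ; ∃; _×_; _,_)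
open import Data.Empty using (⊥)
open import Data.Unit using (⊤)
open import Relation.Binary.PropositionalEquality using (_≡_)
open import Relation.Nullary using (¬_)
open import Data.Nat using (ℕ; _<_)

Letter : Set
Letter = Fin 4

Word : Set
Word = List Letter

Factor : Word → Word → Set
Factor x w = ∃ λ u → ∃ λ v → u ++ x ++ v ≡ w

Prefix : Word → Word → Set
Prefix x w = ∃ λ v → x ++ v ≡ w

Forbidden : Letter → Letter → Set
Forbidden zero (suc (suc zero)) = ⊤
Forbidden (suc (suc zero)) zero = ⊤
Forbidden (suc zero) (suc (suc (suc zero))) = ⊤
Forbidden (suc (suc (suc zero))) (suc zero) = ⊤
Forbidden _ _ = ⊥

Reduced : Word → Set
Reduced w = ∀ a b → Factor (a ∷ b ∷ []) w → ¬ Forbidden a b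

SquareFree : Word → Set
SquareFree w = ∀ u → 0 < length u → ¬ Factor (u ++ u) w

DeanWord : Word → Set
DeanWord w = Reduced w × SquareFree w

InD₃ : Word → Letter → Letter → Letter → Set
InD₃ w a b c =
  Reduced (a ∷ b ∷ c ∷ []) ×
  ¬ Factor (a ∷ b ∷ c ∷ []) w ×
  Factor (a ∷ b ∷ []) w ×
  Factor (b ∷ c ∷ []) w

ReducedLength2 : Letter → Letter → Set
ReducedLength2 a b = ¬ (a ≡ b) × ¬ Forbidden a b

-- Each abc ∈ D₃(w) is an admissible triple (ab and bc are reduced pairs, being factors of the
-- Dean word w), and it occurs in no prefix of w. Of the sixteen admissible triples, a prefix
-- containing ten therefore leaves at most six candidates. That such a prefix exists is checked
-- by a bounded exhaustive search over Dean words built letter by letter: a branch is discarded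
-- as soon as the new letter creates a forbidden pair or a square, succeeds once ten admissible
-- triples have occurred, and must succeed before it could be all of w, i.e. before it has length
-- at least 24 with every reduced pair occurring before its last letter.
module Submission where

open import Defs
open import Data.Bool using (Bool; true; false; T; not; _∧_; _∨_)
open import Data.Bool.ListAction using (all)
open import Data.Bool.Properties using (T-∧; T-∨; T-≡; T?)
open import Data.Empty using (⊥; ⊥-elim)
open import Data.Fin using (zero; suc; _≟_)
open import Data.List using (List; []; _∷_; _++_; _∷ʳ_; [_]; length; reverse; take; drop; upTo; filter; allFin; cartesianProduct)
open import Data.List.Properties using (++-assoc; ++-identityʳ; length-++; length-reverse; reverse-++; reverse-involutive; unfold-reverse; ∷-injectiveˡ; ∷-injectiveʳ)
open import Data.List.Membership.Propositional using (_∈_)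
open import Data.List.Membership.Propositional.Properties using (∈-∃++; ∈-++⁻; ∈-++⁺ˡ; ∈-++⁺ʳ; ∈-filter⁺; ∈-filter⁻; ∈-allFin; ∈-cartesianProduct⁺)
open import Data.List.Relation.Binary.Subset.Propositional using (_⊆_)
open import Data.List.Relation.Unary.All as All using (All)
open import Data.List.Relation.Unary.All.Properties using (all⁺)
open import Data.List.Relation.Unary.Any using (Any; here; there; any?; satisfied)
open import Data.List.Relation.Unary.AllPairs using (_∷_)
open import Data.List.Relation.Unary.Unique.Propositional using (Unique)
open import Data.Nat using (ℕ; zero; suc; _+_; _≤_; _<_; _≤?_; ⌊_/2⌋; z≤n; s≤s)
open import Data.Nat.Properties using (≤-trans; +-suc)
open import Data.Product using (∃; _×_; _,_; proj₁; proj₂)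
open import Data.Sum using (_⊎_; inj₁; inj₂)
open import Data.Unit using (tt)
open import Function using (id; _∘_)
open import Function.Bundles using (Equivalence)
open import Relation.Binary.PropositionalEquality using (_≡_; refl; sym; cong; subst; module ≡-Reasoning)
open import Relation.Nullary using (¬_; Dec; yes; no; isYes; map′; ¬?; _×-dec_; _⊎-dec_)
open import Relation.Nullary.Decidable using (toWitness; toWitnessFalse; fromWitness)
open import Relation.Unary using (Decidable)

open Equivalence using (to; from)

Unique-⊆⇒length≤ : ∀ {A : Set} {xs ys : List A} → Unique xs → xs ⊆ ys → length xs ≤ length ys
Unique-⊆⇒length≤ {xs = []} _ _ = z≤n
Unique-⊆⇒length≤ {xs = x ∷ xs} (x∉xs ∷ unique) xs⊆ys with ys₁ , ys₂ , refl ← ∈-∃++ (xs⊆ys (here refl)) =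
  subst (suc (length xs) ≤_) (sym |ys₁++x∷ys₂|) (s≤s (Unique-⊆⇒length≤ unique xs⊆ys₁++ys₂))
  where
  open ≡-Reasoning
  |ys₁++x∷ys₂| : length (ys₁ ++ x ∷ ys₂) ≡ suc (length (ys₁ ++ ys₂))
  |ys₁++x∷ys₂| = begin
    length (ys₁ ++ x ∷ ys₂)        ≡⟨ length-++ ys₁ ⟩
    length ys₁ + suc (length ys₂)  ≡⟨ +-suc (length ys₁) (length ys₂) ⟩
    suc (length ys₁ + length ys₂)  ≡⟨ cong suc (sym (length-++ ys₁)) ⟩
    suc (length (ys₁ ++ ys₂))      ∎
  xs⊆ys₁++ys₂ : xs ⊆ ys₁ ++ ys₂
  xs⊆ys₁++ys₂ y∈xs with ∈-++⁻ ys₁ (xs⊆ys (there y∈xs))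
  ... | inj₁ y∈ys₁         = ∈-++⁺ˡ y∈ys₁
  ... | inj₂ (here refl)   = ⊥-elim (All.lookup x∉xs y∈xs refl)
  ... | inj₂ (there y∈ys₂) = ∈-++⁺ʳ ys₁ y∈ys₂

reverse-∷-++ : ∀ {A : Set} (c : A) xs ys → reverse (c ∷ xs) ++ ys ≡ reverse xs ++ c ∷ ys
reverse-∷-++ c xs ys = begin
  reverse (c ∷ xs) ++ ys   ≡⟨ cong (_++ ys) (unfold-reverse c xs) ⟩
  (reverse xs ∷ʳ c) ++ ys  ≡⟨ ++-assoc (reverse xs) [ c ] ys ⟩
  reverse xs ++ c ∷ ys     ∎
  where open ≡-Reasoning

Factor-++ʳ : ∀ {x y} z → Factor x y → Factor x (y ++ z)
Factor-++ʳ {x} z (u , v , refl) = u , v ++ z , (begin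
  u ++ x ++ v ++ z    ≡⟨ cong (u ++_) (sym (++-assoc x v z)) ⟩
  u ++ (x ++ v) ++ z  ≡⟨ sym (++-assoc u (x ++ v) z) ⟩
  (u ++ x ++ v) ++ z  ∎)
  where open ≡-Reasoning

Factor-reverse : ∀ {x y} → Factor x y → Factor (reverse x) (reverse y)
Factor-reverse {x} (u , v , refl) = reverse v , reverse u , (begin
  reverse v ++ reverse x ++ reverse u  ≡⟨ sym (++-assoc (reverse v) (reverse x) (reverse u)) ⟩
  (reverse v ++ reverse x) ++ reverse u ≡⟨ cong (_++ reverse u) (sym (reverse-++ x v)) ⟩
  reverse (x ++ v) ++ reverse u        ≡⟨ sym (reverse-++ u (x ++ v)) ⟩
  reverse (u ++ x ++ v)                ∎)
  where open ≡-Reasoning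

Factor-reverse-++ : ∀ {x r} rest → Factor x r → Factor (reverse x) (reverse r ++ rest)
Factor-reverse-++ rest = Factor-++ʳ rest ∘ Factor-reverse

Factor-prefix : ∀ {x p y} → Factor x p → Prefix p y → Factor x y
Factor-prefix x≤p (v , refl) = Factor-++ʳ v x≤p

shorterPrefix-∷ʳ : ∀ {p ys : Word} {x} → Prefix p (ys ∷ʳ x) → length p < length (ys ∷ʳ x) → Prefix p ys
shorterPrefix-∷ʳ {[]}    {ys}     _        _          = ys , refl
shorterPrefix-∷ʳ {_ ∷ _} {[]}     _        (s≤s ())
shorterPrefix-∷ʳ {a ∷ p} {b ∷ ys} (v , eq) (s≤s p<ys) with refl ← ∷-injectiveˡ eq
  with v′ , refl ← shorterPrefix-∷ʳ {p} {ys} (v , ∷-injectiveʳ eq) p<ys = v′ , refl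

startsWith : Word → Word → Bool
startsWith []      _       = true
startsWith (_ ∷ _) []      = false
startsWith (a ∷ x) (b ∷ w) = isYes (a ≟ b) ∧ startsWith x w

occursIn : Word → Word → Bool
occursIn x []      = startsWith x []
occursIn x (b ∷ w) = startsWith x (b ∷ w) ∨ occursIn x w

startsWith-sound : ∀ x w → T (startsWith x w) → Prefix x w
startsWith-sound []      w       _     = w , refl
startsWith-sound (a ∷ x) (b ∷ w) found with a≡b , x≼w ← T-∧ {isYes (a ≟ b)} .to found
  with refl ← toWitness a≡b with v , refl ← startsWith-sound x w x≼w = v , refl

startsWith-complete : ∀ x v → T (startsWith x (x ++ v))
startsWith-complete []      v = tt
startsWith-complete (a ∷ x) v = T-∧ .from (fromWitness {a? = a ≟ a} refl , startsWith-complete x v)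

occursIn-sound : ∀ x w → T (occursIn x w) → Factor x w
occursIn-sound x []      found = [] , startsWith-sound x [] found
occursIn-sound x (b ∷ w) found with T-∨ {startsWith x (b ∷ w)} .to found
... | inj₁ atFront = [] , startsWith-sound x (b ∷ w) atFront
... | inj₂ later with u , v , refl ← occursIn-sound x w later = b ∷ u , v , refl

occursIn-complete : ∀ x u v → T (occursIn x (u ++ x ++ v))
occursIn-complete x [] v with x ++ v | startsWith-complete x v
... | []    | found = found
... | b ∷ w | found = T-∨ {startsWith x (b ∷ w)} .from (inj₁ found)
occursIn-complete x (b ∷ u) v = T-∨ {startsWith x (b ∷ u ++ x ++ v)} .from (inj₂ (occursIn-complete x u v))

prefix? : ∀ x w → Dec (Prefix x w)
prefix? x w = map′ (startsWith-sound x w) (λ { (v , refl) → startsWith-complete x v }) (T? (startsWith x w))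

factor? : ∀ x w → Dec (Factor x w)
factor? x w = map′ (occursIn-sound x w) (λ { (u , v , refl) → occursIn-complete x u v }) (T? (occursIn x w))

pattern 0ℓ = zero
pattern 1ℓ = suc zero
pattern 2ℓ = suc 1ℓ
pattern 3ℓ = suc 2ℓ

letters : List Letter
letters = allFin 4

Triple : Set
Triple = Letter × Letter × Letter

word₃ : Triple → Word
word₃ (a , b , c) = a ∷ b ∷ c ∷ []

forbidden? : ∀ a b → Dec (Forbidden a b)
forbidden? 0ℓ 0ℓ = no id
forbidden? 0ℓ 1ℓ = no id
forbidden? 0ℓ 2ℓ = yes tt
forbidden? 0ℓ 3ℓ = no id
forbidden? 1ℓ 0ℓ = no id
forbidden? 1ℓ 1ℓ = no id
forbidden? 1ℓ 2ℓ = no id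
forbidden? 1ℓ 3ℓ = yes tt
forbidden? 2ℓ 0ℓ = yes tt
forbidden? 2ℓ 1ℓ = no id
forbidden? 2ℓ 2ℓ = no id
forbidden? 2ℓ 3ℓ = no id
forbidden? 3ℓ 0ℓ = no id
forbidden? 3ℓ 1ℓ = yes tt
forbidden? 3ℓ 2ℓ = no id
forbidden? 3ℓ 3ℓ = no id

reducedLength2? : ∀ a b → Dec (ReducedLength2 a b)
reducedLength2? a b = ¬? (a ≟ b) ×-dec ¬? (forbidden? a b)

ReducedPair : Letter × Letter → Set
ReducedPair (a , b) = ReducedLength2 a b

reducedPair? : Decidable ReducedPair
reducedPair? (a , b) = reducedLength2? a b

reducedPairs : List (Letter × Letter)
reducedPairs = filter reducedPair? (cartesianProduct letters letters)

Admissible : Triple → Set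
Admissible (a , b , c) = ReducedLength2 a b × ReducedLength2 b c

admissible? : Decidable Admissible
admissible? (a , b , c) = reducedLength2? a b ×-dec reducedLength2? b c

-- The sixteen admissible triples, spelled out so that the search below does not recompute the filter.
admissibleTriples : List Triple
admissibleTriples =
  (0ℓ , 1ℓ , 0ℓ) ∷ (0ℓ , 1ℓ , 2ℓ) ∷ (0ℓ , 3ℓ , 0ℓ) ∷ (0ℓ , 3ℓ , 2ℓ) ∷
  (1ℓ , 0ℓ , 1ℓ) ∷ (1ℓ , 0ℓ , 3ℓ) ∷ (1ℓ , 2ℓ , 1ℓ) ∷ (1ℓ , 2ℓ , 3ℓ) ∷
  (2ℓ , 1ℓ , 0ℓ) ∷ (2ℓ , 1ℓ , 2ℓ) ∷ (2ℓ , 3ℓ , 0ℓ) ∷ (2ℓ , 3ℓ , 2ℓ) ∷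
  (3ℓ , 0ℓ , 1ℓ) ∷ (3ℓ , 0ℓ , 3ℓ) ∷ (3ℓ , 2ℓ , 1ℓ) ∷ (3ℓ , 2ℓ , 3ℓ) ∷ []

admissibleTriples-filter :
  filter admissible? (cartesianProduct letters (cartesianProduct letters letters)) ≡ admissibleTriples
admissibleTriples-filter = refl

admissible∈admissibleTriples : ∀ {t} → Admissible t → t ∈ admissibleTriples
admissible∈admissibleTriples {a , b , c} admissible = subst ((a , b , c) ∈_) admissibleTriples-filter
  (∈-filter⁺ admissible? (∈-cartesianProduct⁺ (∈-allFin a) (∈-cartesianProduct⁺ (∈-allFin b) (∈-allFin c))) admissible)

factor-reducedLength2 : ∀ {w a b} → DeanWord w → Factor (a ∷ b ∷ []) w → ReducedLength2 a b
factor-reducedLength2 {a = a} (reduced , squareFree) ab≤w =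
  (λ { refl → squareFree [ a ] (s≤s z≤n) ab≤w }) , reduced _ _ ab≤w

PairsOccurEarly : Word → Set
PairsOccurEarly w = ∀ a b → ReducedLength2 a b →
  ∃ λ p → Prefix p w × length p < length w × Factor (a ∷ b ∷ []) p

Hypotheses : Word → Set
Hypotheses w = DeanWord w × 24 ≤ length w × PairsOccurEarly w

D₃AtMost : ℕ → Word → Set
D₃AtMost k w = (L : List Triple) → Unique L → (∀ {a b c} → (a , b , c) ∈ L → InD₃ w a b c) → length L ≤ k

pairsOccurBeforeLastLetter : ∀ {ys x a b} → PairsOccurEarly (ys ∷ʳ x) → ReducedLength2 a b → Factor (a ∷ b ∷ []) ys
pairsOccurBeforeLastLetter early ab with _ , p≼w , p<w , ab≤p ← early _ _ ab =
  Factor-prefix ab≤p (shorterPrefix-∷ʳ p≼w p<w)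

-- From here on a prefix of w is handled through its reversal r, so that extending the prefix
-- by a letter is a cons, and everything the new letter creates sits at the front of r.

Unseen : Word → Triple → Set
Unseen r t = ¬ Factor (reverse (word₃ t)) r

unseen? : ∀ r → Decidable (Unseen r)
unseen? r t = ¬? (factor? (reverse (word₃ t)) r)

unseen : Word → List Triple
unseen r = filter (unseen? r) admissibleTriples

D₃⊆unseen : ∀ {r} rest {a b c} → DeanWord (reverse r ++ rest) → InD₃ (reverse r ++ rest) a b c →
  (a , b , c) ∈ unseen r
D₃⊆unseen {r} rest dean (_ , abc≰w , ab≤w , bc≤w) =
  ∈-filter⁺ (unseen? r)
    (admissible∈admissibleTriples (factor-reducedLength2 dean ab≤w , factor-reducedLength2 dean bc≤w))
    (abc≰w ∘ Factor-reverse-++ rest)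

unseen-bound : ∀ {r k} rest → DeanWord (reverse r ++ rest) → length (unseen r) ≤ k →
  D₃AtMost k (reverse r ++ rest)
unseen-bound {r} rest dean few L unique inD₃ = ≤-trans (Unique-⊆⇒length≤ {ys = unseen r} unique L⊆unseen) few
  where
  L⊆unseen : L ⊆ unseen r
  L⊆unseen {_ , _ , _} t∈L = D₃⊆unseen {r} rest dean (inD₃ t∈L)

ForbiddenAtFront : Word → Set
ForbiddenAtFront (b ∷ a ∷ _) = Forbidden a b
ForbiddenAtFront _           = ⊥

forbiddenAtFront? : Decidable ForbiddenAtFront
forbiddenAtFront? []          = no id
forbiddenAtFront? (_ ∷ [])    = no id
forbiddenAtFront? (b ∷ a ∷ _) = forbidden? a b

SquareAtFront : Word → Set
SquareAtFront r = Any (λ k → Prefix (take (suc k) r ++ take (suc k) r) r) (upTo ⌊ length r /2⌋)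

squareAtFront? : Decidable SquareAtFront
squareAtFront? r = any? (λ k → prefix? (take (suc k) r ++ take (suc k) r) r) (upTo ⌊ length r /2⌋)

forbiddenAtFront⇒¬Reduced : ∀ {r} rest → ForbiddenAtFront r → ¬ Reduced (reverse r ++ rest)
forbiddenAtFront⇒¬Reduced {b ∷ a ∷ r} rest forbidden reduced =
  reduced a b (Factor-reverse-++ {b ∷ a ∷ []} {b ∷ a ∷ r} rest ([] , r , refl)) forbidden

squareAtFront⇒¬SquareFree : ∀ {r} rest → SquareAtFront r → ¬ SquareFree (reverse r ++ rest)
squareAtFront⇒¬SquareFree {x ∷ r} rest square squareFree with k , uu≼r ← satisfied square =
  squareFree (reverse u) (subst (0 <_) (sym (length-reverse u)) (s≤s z≤n))
    (subst (λ y → Factor y _) (reverse-++ u u) (Factor-reverse-++ {r = x ∷ r} rest ([] , uu≼r)))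
  where
  u : Word
  u = x ∷ take k r

FrontDefect : Word → Set
FrontDefect r = ForbiddenAtFront r ⊎ SquareAtFront r

frontDefect? : Decidable FrontDefect
frontDefect? r = forbiddenAtFront? r ⊎-dec squareAtFront? r

frontDefect⇒¬Dean : ∀ {r} rest → FrontDefect r → ¬ DeanWord (reverse r ++ rest)
frontDefect⇒¬Dean {r} rest (inj₁ forbidden) (reduced , _) = forbiddenAtFront⇒¬Reduced {r} rest forbidden reduced
frontDefect⇒¬Dean {r} rest (inj₂ square) (_ , squareFree) = squareAtFront⇒¬SquareFree {r} rest square squareFree

CanBeWhole : Word → Set
CanBeWhole r = 24 ≤ length r × All (λ (a , b) → Factor (b ∷ a ∷ []) (drop 1 r)) reducedPairs

canBeWhole? : Decidable CanBeWhole
canBeWhole? r = 24 ≤? length r ×-dec All.all? (λ (a , b) → factor? (b ∷ a ∷ []) (drop 1 r)) reducedPairs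

hypotheses⇒canBeWhole : ∀ r → Hypotheses (reverse r) → CanBeWhole r
hypotheses⇒canBeWhole [] (_ , () , _)
hypotheses⇒canBeWhole (x ∷ t) (_ , 24≤|w| , early) =
  subst (24 ≤_) (length-reverse (x ∷ t)) 24≤|w| , All.tabulate ba≤t
  where
  ba≤t : ∀ {ab} → ab ∈ reducedPairs → Factor (proj₂ ab ∷ proj₁ ab ∷ []) t
  ba≤t {a , b} ab∈pairs = subst (Factor (b ∷ a ∷ [])) (reverse-involutive t) (Factor-reverse
    (pairsOccurBeforeLastLetter (subst PairsOccurEarly (unfold-reverse x t) early)
      (proj₂ (∈-filter⁻ reducedPair? {xs = cartesianProduct letters letters} ab∈pairs))))

rest-nonempty : ∀ r {rest} → ¬ CanBeWhole r → Hypotheses (reverse r ++ rest) →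
  ∃ λ c → ∃ λ rest′ → rest ≡ c ∷ rest′
rest-nonempty r {[]} notWhole hyps =
  ⊥-elim (notWhole (hypotheses⇒canBeWhole r (subst Hypotheses (++-identityʳ (reverse r)) hyps)))
rest-nonempty r {c ∷ rest′} _ _ = c , rest′ , refl

search : ℕ → Word → Bool
search zero    _ = false
search (suc n) r =
  isYes (frontDefect? r) ∨ isYes (length (unseen r) ≤? 6) ∨
  not (isYes (canBeWhole? r)) ∧ all (λ c → search n (c ∷ r)) letters

search-step : ∀ n r → T (search (suc n) r) →
  FrontDefect r ⊎ length (unseen r) ≤ 6 ⊎ ¬ CanBeWhole r × All (λ c → T (search n (c ∷ r))) letters
search-step n r found with T-∨ {isYes (frontDefect? r)} .to found
... | inj₁ defect = inj₁ (toWitness {a? = frontDefect? r} defect)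
... | inj₂ found′ with T-∨ {isYes (length (unseen r) ≤? 6)} .to found′
...   | inj₁ few    = inj₂ (inj₁ (toWitness {a? = length (unseen r) ≤? 6} few))
...   | inj₂ extend with notWhole , children ← T-∧ {not (isYes (canBeWhole? r))} .to extend =
  inj₂ (inj₂ (toWitnessFalse {a? = canBeWhole? r} notWhole , all⁺ (λ c → search n (c ∷ r)) letters children))

-- Stated with ≡ true rather than T: type-checking T (search 31 []) directly is several times slower
-- than the refl in search-succeeds.
search-sound : ∀ n r rest → search n r ≡ true → Hypotheses (reverse r ++ rest) →
  D₃AtMost 6 (reverse r ++ rest)
search-sound (suc n) r rest found hyps@(dean , _) with search-step n r (T-≡ .from found)
... | inj₁ defect        = ⊥-elim (frontDefect⇒¬Dean {r} rest defect dean)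
... | inj₂ (inj₁ few)    = unseen-bound {r} rest dean few
... | inj₂ (inj₂ (notWhole , children)) with c , rest′ , refl ← rest-nonempty r notWhole hyps =
  subst (D₃AtMost 6) (reverse-∷-++ c r rest′)
    (search-sound n (c ∷ r) rest′ (T-≡ .to (All.lookup children (∈-allFin c)))
      (subst Hypotheses (sym (reverse-∷-++ c r rest′)) hyps))

search-succeeds : search 31 [] ≡ true
search-succeeds = refl

mainTheorem4 : (w : Word) → DeanWord w → 24 ≤ length w →
    (∀ a b → ReducedLength2 a b →
      ∃ λ p → Prefix p w × length p < length w × Factor (a ∷ b ∷ []) p) →
    (L : List (Letter × Letter × Letter)) → Unique L →
    (∀ {a b c} → (a , b , c) ∈ L → InD₃ w a b c) →
    length L ≤ 6
mainTheorem4 w dean 24≤|w| early = search-sound 31 [] w search-succeeds (dean , 24≤|w| , early)
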